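{- There is no strategy-proof algorithm (mechanism) that finds a stable matching in the geometric preference model.
   Context: A matching market has $n$ men and $n$ women. In the $d$-dimensional geometric model every participant $x$ has a location $p(x)\in\mathbb{R}^d$ and an ideal $q(x)\in\mathbb{R}^d$; a man $m$ prefers woman $w_1$ to $w_2$ iff $\|q(m)-p(w_1)\|_2^2<\|q(m)-p(w_2)\|_2^2$, and symmetrically for women. A matching $\mu$ is stable if there is no pair $(m,w)\notin\mu$ with $m$ strictly preferring $w$ to $\mu(m)$ and $w$ strictly preferring $m$ to $\mu(w)$. A mechanism takes the reported ideals of all participants (locations are fixed and cannot be misreported) and outputs a matching stable with respect to the reported preferences. It is strategy-proof if no participant can ever obtain a partner he or she strictly prefers (according to the true ideal) by reporting a different ideal while all others report truthfully.
   Formalization: Locations, ideals and misreported ideals are taken in ℚ^d rather than $\mathbb{R}^d$. -}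

module Defs where

open import Data.Nat using (ℕ)
open import Data.Fin using (Fin; _≟_)
open import Data.Vec using (Vec; []; _∷_)
open import Data.Rational using (ℚ; 0ℚ; _+_; _-_; _*_; _<_)
open import Data.Product using (Σ; _×_)
open import Data.Fin.Permutation using (Permutation′; _⟨$⟩ʳ_; _⟨$⟩ˡ_)
open import Relation.Nullary using (¬_; yes; no)
open import Relation.Binary.PropositionalEquality using (_≢_)

Point : ℕ → Set
Point d = Vec ℚ d

sqDist : ∀ {d} → Point d → Point d → ℚ
sqDist []       []       = 0ℚ
sqDist (x ∷ xs) (y ∷ ys) = ((x - y) * (x - y)) + sqDist xs ys

Profile : ℕ → ℕ → Set
Profile n d = Fin n → Point d

-- A (perfect) matching between n men and n women: man m is matched to μ ⟨$⟩ʳ m,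
-- woman w to μ ⟨$⟩ˡ w.
Matching : ℕ → Set
Matching n = Permutation′ n

Prefers : ∀ {d} → Point d → Point d → Point d → Set
Prefers q a b = sqDist q a < sqDist q b

Blocking : ∀ {n d} (locM locW idM idW : Profile n d) → Matching n → Fin n → Fin n → Set
Blocking locM locW idM idW μ m w =
  (μ ⟨$⟩ʳ m ≢ w)
  × Prefers (idM m) (locW w) (locW (μ ⟨$⟩ʳ m))
  × Prefers (idW w) (locM m) (locM (μ ⟨$⟩ˡ w))

Stable : ∀ {n d} (locM locW idM idW : Profile n d) → Matching n → Set
Stable locM locW idM idW μ = ∀ m w → ¬ Blocking locM locW idM idW μ m w

update : ∀ {n d} → Profile n d → Fin n → Point d → Profile n d
update p i q j with j ≟ i
... | yes _ = q
... | no  _ = p j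

Mechanism : Set
Mechanism = (n d : ℕ) (locM locW : Profile n d) →
  Σ ((idM idW : Profile n d) → Matching n) λ f →
    ∀ idM idW → Stable locM locW idM idW (f idM idW)

StrategyProof : Mechanism → Set
StrategyProof M = ∀ n d (locM locW : Profile n d) (idM idW : Profile n d) →
  let f = Σ.proj₁ (M n d locM locW) in
  (∀ m (q : Point d) →
     ¬ Prefers (idM m) (locW (f (update idM m q) idW ⟨$⟩ʳ m))
                       (locW (f idM idW ⟨$⟩ʳ m)))
  × (∀ w (q : Point d) →
     ¬ Prefers (idW w) (locM (f idM (update idW w q) ⟨$⟩ˡ w))
                       (locM (f idM idW ⟨$⟩ˡ w)))

{-# OPTIONS --safe #-}
-- Take a one-dimensional market with three men and three women that has two
-- stable matchings: the man-optimal one, pairing man 0 with his favourite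
-- woman 2, and the woman-optimal one, pairing woman 0 with her favourite man 0.
-- If man 0 reports the ideal 4, only the man-optimal matching stays stable; if
-- woman 0 reports 4, only the woman-optimal one does.  So a strategy-proof
-- mechanism would have to give both of them their favourite partner on the
-- truthful reports, which no single matching does.
module Submission where

open import Defs
open import Data.Fin using (Fin; _≟_)
open import Data.Fin.Patterns using (0F; 2F)
open import Data.Fin.Permutation using (_⟨$⟩ʳ_; _⟨$⟩ˡ_; inverseˡ; inverseʳ)
open import Data.Fin.Properties using (all?)
open import Data.Integer using (+_)
open import Data.Nat using (ℕ; zero; suc)
open import Data.Product using (Σ; _×_; _,_; proj₁; proj₂)
open import Data.Rational using (_/_)
open import Data.Rational.Properties using (_<?_)
open import Data.Vec using (Vec; []; _∷_; lookup; tabulate)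
open import Data.Vec.Properties using (lookup∘tabulate)
open import Function using (Inverse; _∘_)
open import Function.Bundles using (Injection)
open import Function.Properties.Inverse using (↔⇒↣)
open import Relation.Binary.PropositionalEquality
  using (_≡_; _≢_; _≗_; sym; trans; cong; subst; subst₂; module ≡-Reasoning)
open import Relation.Nullary using (¬_; Dec; contradiction)
open import Relation.Nullary.Decidable using (yes; no; map′; from-yes; ¬?; _×-dec_; _→-dec_)
open import Relation.Unary using (Pred; Decidable)

∀-vec? : ∀ {k n p} {P : Pred (Vec (Fin k) n) p} → Decidable P → Dec (∀ v → P v)
∀-vec? {n = zero}  P? = map′ (λ { p [] → p }) (λ h → h []) (P? [])
∀-vec? {n = suc n} P? =
  map′ (λ { h (x ∷ xs) → h x xs }) (λ h x xs → h (x ∷ xs))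
       (all? λ x → ∀-vec? λ xs → P? (x ∷ xs))

prefers? : ∀ {d} (q a b : Point d) → Dec (Prefers q a b)
prefers? q a b = sqDist q a <? sqDist q b

Favourite : ∀ {n d} → Point d → Profile n d → Fin n → Set
Favourite q loc w = ∀ x → x ≢ w → Prefers q (loc w) (loc x)

favourite? : ∀ {n d} (q : Point d) (loc : Profile n d) (w : Fin n) → Dec (Favourite q loc w)
favourite? q loc w = all? λ x → ¬? (x ≟ w) →-dec prefers? q (loc w) (loc x)

favourite-unbeaten⇒≡ : ∀ {n d} {q : Point d} {loc : Profile n d} {w} x →
  Favourite q loc w → ¬ Prefers q (loc w) (loc x) → x ≡ w
favourite-unbeaten⇒≡ {w = w} x fav ¬pref with x ≟ w
... | yes x≡w = x≡w
... | no  x≢w = contradiction (fav x x≢w) ¬pref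

run : Mechanism → ∀ {n d} (locM locW idM idW : Profile n d) → Matching n
run M {n} {d} locM locW = proj₁ (M n d locM locW)

run-stable : ∀ M {n d} (locM locW idM idW : Profile n d) →
  Stable locM locW idM idW (run M locM locW idM idW)
run-stable M {n} {d} locM locW = proj₂ (M n d locM locW)

module _ (M : Mechanism) (sp : StrategyProof M) {n d : ℕ} (locM locW idM idW : Profile n d) where

  favourite-secured-by-man : ∀ m q {w} → Favourite (idM m) locW w →
    run M locM locW (update idM m q) idW ⟨$⟩ʳ m ≡ w →
    run M locM locW idM idW ⟨$⟩ʳ m ≡ w
  favourite-secured-by-man m q fav secured =
    favourite-unbeaten⇒≡ {q = idM m} {loc = locW} _ fav λ pref →
      proj₁ (sp n d locM locW idM idW) m q
        (subst (λ w → Prefers (idM m) (locW w) _) (sym secured) pref)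

  favourite-secured-by-woman : ∀ w q {m} → Favourite (idW w) locM m →
    run M locM locW idM (update idW w q) ⟨$⟩ˡ w ≡ m →
    run M locM locW idM idW ⟨$⟩ˡ w ≡ m
  favourite-secured-by-woman w q fav secured =
    favourite-unbeaten⇒≡ {q = idW w} {loc = locM} _ fav λ pref →
      proj₂ (sp n d locM locW idM idW) w q
        (subst (λ m → Prefers (idW w) (locM m) _) (sym secured) pref)

module _ {n d : ℕ} (locM locW idM idW : Profile n d) where

  -- The blocking woman is named as the partner r m′ of a man m′, so no inverse
  -- map is needed and r may be any function.
  MapBlocking : (Fin n → Fin n) → Fin n → Fin n → Set
  MapBlocking r m m′ =
    r m ≢ r m′
    × Prefers (idM m) (locW (r m′)) (locW (r m))
    × Prefers (idW (r m′)) (locM m) (locM m′)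

  MapStable : (Fin n → Fin n) → Set
  MapStable r = ∀ m m′ → ¬ MapBlocking r m m′

  MapInjective : (Fin n → Fin n) → Set
  MapInjective r = ∀ i j → r i ≡ r j → i ≡ j

  mapStable? : ∀ r → Dec (MapStable r)
  mapStable? r = all? λ m → all? λ m′ → ¬?
    (¬? (r m ≟ r m′)
      ×-dec prefers? (idM m) (locW (r m′)) (locW (r m))
      ×-dec prefers? (idW (r m′)) (locM m) (locM m′))

  mapInjective? : ∀ r → Dec (MapInjective r)
  mapInjective? r = all? λ i → all? λ j → (r i ≟ r j) →-dec (i ≟ j)

  mapBlocking-resp : ∀ {r s} → r ≗ s → ∀ {m m′} → MapBlocking r m m′ → MapBlocking s m m′
  mapBlocking-resp {r} {s} r≗s {m} {m′} (r≢ , manPrefers , womanPrefers) =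
      (λ s≡ → r≢ (trans (r≗s m) (trans s≡ (sym (r≗s m′)))))
    , subst₂ (λ w w′ → Prefers (idM m) (locW w′) (locW w)) (r≗s m) (r≗s m′) manPrefers
    , subst (λ w′ → Prefers (idW w′) (locM m) (locM m′)) (r≗s m′) womanPrefers

  stable⇒mapStable : ∀ μ → Stable locM locW idM idW μ → MapStable (μ ⟨$⟩ʳ_)
  stable⇒mapStable μ stable m m′ (≢ , manPrefers , womanPrefers) =
    stable m (μ ⟨$⟩ʳ m′)
      (≢ , manPrefers , subst (λ x → Prefers (idW (μ ⟨$⟩ʳ m′)) (locM m) (locM x))
                (sym (inverseˡ μ)) womanPrefers)

  -- Quantifying over vectors rather than permutations makes the premise decidable.
  PartnerInStableMaps : Fin n → Fin n → Set
  PartnerInStableMaps m w =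
    ∀ v → MapInjective (lookup v) → MapStable (lookup v) → lookup v m ≡ w

  partnerInStableMaps? : ∀ m w → Dec (PartnerInStableMaps m w)
  partnerInStableMaps? m w = ∀-vec? λ v →
    mapInjective? (lookup v) →-dec (mapStable? (lookup v) →-dec (lookup v m ≟ w))

  partnerInStableMaps⇒partner : ∀ {m w} → PartnerInStableMaps m w →
    ∀ μ → Stable locM locW idM idW μ → μ ⟨$⟩ʳ m ≡ w
  partnerInStableMaps⇒partner {m} partner μ stable =
    trans (μ≗v m) (partner v injective (λ i j → stable⇒mapStable μ stable i j ∘ resp))
    where
    v : Vec (Fin n) n
    v = tabulate (μ ⟨$⟩ʳ_)
    μ≗v : (μ ⟨$⟩ʳ_) ≗ lookup v
    μ≗v i = sym (lookup∘tabulate (μ ⟨$⟩ʳ_) i)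
    resp : ∀ {i j} → MapBlocking (lookup v) i j → MapBlocking (μ ⟨$⟩ʳ_) i j
    resp = mapBlocking-resp (sym ∘ μ≗v)
    injective : MapInjective (lookup v)
    injective i j e = Injection.injective (↔⇒↣ μ) (trans (μ≗v i) (trans e (sym (μ≗v j))))

at : ℕ → Point 1
at k = (+ k / 1) ∷ []

-- Preferences, best first.  Man 0: w2 w0 w1 (reporting 4: w2 w1 w0); men 1, 2:
-- w0 w2 w1.  Woman 0: m0 m2 m1 (reporting 4: m0 m1 m2); women 1, 2: m2 m0 m1.
menAt womenAt menIdeal womenIdeal : Profile 3 1
menAt      = lookup (at 6  ∷ at 0  ∷ at 10 ∷ [])
womenAt    = lookup (at 14 ∷ at 0  ∷ at 6  ∷ [])
menIdeal   = lookup (at 8  ∷ at 11 ∷ at 16 ∷ [])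
womenIdeal = lookup (at 7  ∷ at 10 ∷ at 10 ∷ [])

lie : Point 1
lie = at 4

man₀-favours-woman₂ : Favourite (menIdeal 0F) womenAt 2F
man₀-favours-woman₂ = from-yes (favourite? (menIdeal 0F) womenAt 2F)

woman₀-favours-man₀ : Favourite (womenIdeal 0F) menAt 0F
woman₀-favours-man₀ = from-yes (favourite? (womenIdeal 0F) menAt 0F)

lie-of-man₀-secures-woman₂ : ∀ M →
  run M menAt womenAt (update menIdeal 0F lie) womenIdeal ⟨$⟩ʳ 0F ≡ 2F
lie-of-man₀-secures-woman₂ M =
  partnerInStableMaps⇒partner menAt womenAt reports womenIdeal
    (from-yes (partnerInStableMaps? menAt womenAt reports womenIdeal 0F 2F))
    μ (run-stable M menAt womenAt reports womenIdeal)
  where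
  reports : Profile 3 1
  reports = update menIdeal 0F lie
  μ : Matching 3
  μ = run M menAt womenAt reports womenIdeal

lie-of-woman₀-secures-man₀ : ∀ M →
  run M menAt womenAt menIdeal (update womenIdeal 0F lie) ⟨$⟩ˡ 0F ≡ 0F
lie-of-woman₀-secures-man₀ M =
  Inverse.inverseʳ μ (sym (partnerInStableMaps⇒partner menAt womenAt menIdeal reports
    (from-yes (partnerInStableMaps? menAt womenAt menIdeal reports 0F 0F))
    μ (run-stable M menAt womenAt menIdeal reports)))
  where
  reports : Profile 3 1
  reports = update womenIdeal 0F lie
  μ : Matching 3
  μ = run M menAt womenAt menIdeal reports

truthful : Mechanism → Matching 3
truthful M = run M menAt womenAt menIdeal womenIdeal

module _ (M : Mechanism) (sp : StrategyProof M) where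

  man₀-gets-woman₂ : truthful M ⟨$⟩ʳ 0F ≡ 2F
  man₀-gets-woman₂ =
    favourite-secured-by-man M sp menAt womenAt menIdeal womenIdeal 0F lie man₀-favours-woman₂
      (lie-of-man₀-secures-woman₂ M)

  woman₀-gets-man₀ : truthful M ⟨$⟩ˡ 0F ≡ 0F
  woman₀-gets-man₀ =
    favourite-secured-by-woman M sp menAt womenAt menIdeal womenIdeal 0F lie woman₀-favours-man₀
      (lie-of-woman₀-secures-man₀ M)

theorem12 : ¬ Σ Mechanism StrategyProof
theorem12 (M , sp) = contradiction
  (begin
    0F                  ≡⟨ sym (inverseʳ μ) ⟩
    μ ⟨$⟩ʳ (μ ⟨$⟩ˡ 0F)  ≡⟨ cong (μ ⟨$⟩ʳ_) (woman₀-gets-man₀ M sp) ⟩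
    μ ⟨$⟩ʳ 0F           ≡⟨ man₀-gets-woman₂ M sp ⟩
    2F                  ∎)
  λ ()
  where
  open ≡-Reasoning
  μ : Matching 3
  μ = truthful M
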